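{- Let $n \geq 2$ and $d \geq 2n$. There exists an adaptive adversary $Z \in \mathrm{Adv}(\mathcal{D}_1(n,d))$ such that \[ p_{\textsc{Cluster}}(Z) = \Omega\Big(\min\Big(1, \frac{n^2 d}{m}\Big)\Big). \]
   Context: Fix $m\in\mathbb N$ and the universe of IDs $[m]=\{1,\dots,m\}$. An ID-generation algorithm $\mathcal A$ is a probability distribution over permutations of $[m]$: an instance draws a permutation (independently of other instances) and answers its $t$-th request with the $t$-th entry. An adaptive adversary $Z$ plays the following game: starting from the empty demand profile $D=()$, when $D=(d_1,\dots,d_i)$ it either activates a new instance (request an ID from it, $D\gets(d_1,\dots,d_i,1)$), requests another ID from some existing instance $j$ ($d_j\gets d_j+1$), or stops, making $D$ the final demand profile; at each step it observes the ID produced and may base future decisions on all IDs seen so far. A collision occurs if some ID is output by two different instances; $p_{\mathcal A}(Z)$ is the collision probability of this game. For a set $\mathcal D$ of demand profiles, $\mathrm{Adv}(\mathcal D)$ is the set of adaptive adversaries that always stop eventually with a final demand profile in $\mathcal D$. $\mathcal D_1(n,d)=\{D\in[m]^n:\sum_i d_i=d\}$. Cluster: pick $x\in[m]$ uniformly at random and return $x,x+1,\dots$ modulo $m$. $\Omega$ hides an absolute constant independent of all parameters. -}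

module Defs where

open import Data.Nat using (ℕ; zero; suc; _+_; _*_; _^_; _≤_; _<_; _<?_; _≡ᵇ_; NonZero)
open import Data.Nat.Properties using (m^n≢0)
open import Data.Nat.DivMod using (_mod_)
open import Data.Fin using (Fin; toℕ; fromℕ<)
open import Data.Vec using (Vec; []; _∷_; lookup)
open import Data.List using (List; []; _∷_; _++_; [_]; length; map; concatMap; allFin)
open import Data.Nat.ListAction using (sum)
open import Data.Bool.ListAction using (any)
open import Data.List.Relation.Unary.All using (All)
open import Data.Bool using (Bool; true; false; not; _∧_; _∨_; if_then_else_)
open import Data.Maybe using (Maybe; just; nothing; maybe′)
open import Data.Product using (_×_; _,_; ∃)
open import Data.Integer using (+_)
open import Data.Rational using (ℚ; _/_)
open import Relation.Nullary using (yes; no)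
open import Relation.Binary.PropositionalEquality using (_≡_)
open import Function.Definitions using (Injective)

-- IDs are Fin m (representing [m] = {1..m} shifted by one).
-- Instances are numbered 0,1,2,... in order of activation.

data Action : Set where
  activate : Action          -- activate a new instance and request an ID from it
  request  : ℕ → Action
  stop     : Action

-- Observed history: list of (instance index, ID produced), most recent first.
History : ℕ → Set
History m = List (ℕ × Fin m)

Adversary : ℕ → Set
Adversary m = History m → Action

lookupD : List ℕ → ℕ → Maybe ℕ
lookupD []       _       = nothing
lookupD (x ∷ xs) zero    = just x
lookupD (x ∷ xs) (suc j) = lookupD xs j

incr : List ℕ → ℕ → List ℕ
incr []       _       = []
incr (x ∷ xs) zero    = suc x ∷ xs
incr (x ∷ xs) (suc j) = x ∷ incr xs j

-- Run the game for at most `fuel` adversary decisions.  π i is the permutation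
-- drawn by instance i (its t-th request, t = 0,1,..., is answered by π i t).
-- Only n instances are available: activating an (n+1)-th instance, requesting a
-- nonexistent instance, requesting more than m IDs from an instance, or running out of
-- fuel yields `nothing` (such runs can never end in a profile of D₁(n,d)).
run : ∀ {m n} → Adversary m → (Fin n → Fin m → Fin m) → ℕ →
      List ℕ → History m → Maybe (List ℕ × History m)
run Z π zero D h = nothing
run {m} {n} Z π (suc f) D h = go (Z h)
  where
  emit : ℕ → ℕ → List ℕ → Maybe (List ℕ × History m)
  emit i c D' with i <? n | c <? m
  ... | yes p | yes q = run Z π f D' ((i , π (fromℕ< p) (fromℕ< q)) ∷ h)
  ... | _     | _     = nothing
  go : Action → Maybe (List ℕ × History m)
  go stop        = just (D , h)
  go activate    = emit (length D) 0 (D ++ [ 1 ])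
  go (request j) = maybe′ (λ c → emit j c (incr D j)) nothing (lookupD D j)

InD1 : (m n d : ℕ) → List ℕ → Set
InD1 m n d D = length D ≡ n × All (λ x → 1 ≤ x × x ≤ m) D × sum D ≡ d

-- Z ∈ Adv(D₁(n,d)): whatever (permutation-valued) answers the instances give,
-- the adversary stops (necessarily after its d requests, i.e. within d+1 decisions)
-- with final demand profile in D₁(n,d).
Valid : (m n d : ℕ) → Adversary m → Set
Valid m n d Z = (π : Fin n → Fin m → Fin m) → (∀ i → Injective _≡_ _≡_ (π i)) →
  ∃ λ r → run Z π (suc d) [] [] ≡ just r × InD1 m n d (Data.Product.proj₁ r)

collides : ∀ {m} → History m → Bool
collides [] = false
collides ((i , a) ∷ h) =
  any (λ e → not (i ≡ᵇ Data.Product.proj₁ e) ∧ (toℕ a ≡ᵇ toℕ (Data.Product.proj₂ e))) h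
  ∨ collides h

-- Cluster: instance i draws x uniformly and outputs x, x+1, ... (mod m).
cluster : ∀ {m n} .{{_ : NonZero m}} → Vec (Fin m) n → Fin n → Fin m → Fin m
cluster {m} x i t = (toℕ (lookup x i) + toℕ t) mod m

-- all vectors of starting points (the sample space of n independent Cluster instances)
allVecs : ∀ {m} (n : ℕ) → List (Vec (Fin m) n)
allVecs zero    = [ [] ]
allVecs {m} (suc n) = concatMap (λ a → map (a ∷_) (allVecs n)) (allFin m)

collisionOn : ∀ {m} → Maybe (List ℕ × History m) → ℕ
collisionOn nothing        = 0
collisionOn (just (_ , h)) = if collides h then 1 else 0

-- p_Cluster(Z) for Z ∈ Adv(D₁(n,d)) (runs of valid adversaries end within d+1 decisions)
pCluster : (m n d : ℕ) .{{_ : NonZero m}} → Adversary m → ℚ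
pCluster m n d Z =
  _/_ (+ sum (map (λ x → collisionOn {m} (run {m} {n} Z (cluster x) (suc d) [] [])) (allVecs {m} n)))
      (m ^ n) {{m^n≢0 m n}}

-- The adversary activates all n instances, which reveals their starting points, and elects as
-- leader an instance i such that another instance j started at most K = min(d − n, m − 1) steps
-- after it on the cycle ℤ/m. Giving the leader K + 1 requests (and the rest of the demand d to the
-- others) makes it output the start of j: a collision. A leader exists unless the starts are
-- "spread", i.e. pairwise more than K apart in both directions. Choosing starts one at a time, a new
-- point avoids the windows of k spread points in at most m − k(K + 1) ways, and induction gives
-- #spread(n) · (m + S) ≤ m^(n+1) with S = (K + 1) n (n − 1) / 2. So Cluster collides with
-- probability at least S / (m + S) ≥ min(1, S / m) / 2, and S ≥ n² d / 8 when K = d − n,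
-- while S ≥ m when K = m − 1.

module Submission where

open import Data.Bool using (Bool; true; false; T; not; _∧_; _∨_; if_then_else_)
open import Data.Bool.Properties using (T-∧; T-∨)
open import Data.Empty using (⊥-elim)
open import Data.Fin as Fin using (Fin; toℕ; fromℕ<)
open import Data.Fin.Properties using (toℕ<n; toℕ-fromℕ<; fromℕ<-toℕ; toℕ-injective) renaming (suc-injective to Fin-suc-injective)
open import Data.List using (List; []; _∷_; _++_; [_]; length; map; concatMap; tabulate; allFin; take; drop; replicate)
open import Data.List.Membership.Propositional using (_∈_; find; lose)
open import Data.List.Membership.Propositional.Properties using (∈-++⁺ʳ)
open import Data.List.Properties using (map-++; map-tabulate; map-∘; length-++; length-replicate; take++drop≡id; ++-assoc)
open import Data.List.Relation.Unary.All as All using (All; []; _∷_)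
open import Data.List.Relation.Unary.All.Properties using (++⁺; take⁺; drop⁺)
open import Data.List.Relation.Unary.Any using (Any; here; there; any?)
open import Data.List.Relation.Unary.Any.Properties using (any⁺)
open import Data.Maybe using (just)
open import Data.Nat as ℕ hiding (_/_; _⊓_)
open import Data.Nat.DivMod using (_%_; m<n⇒m%n≡m; [m+n]%n≡m%n)
open import Data.Nat.ListAction using (sum)
open import Data.Nat.ListAction.Properties using (sum-++)
open import Data.Nat.Properties
open import Algebra.Properties.CommutativeSemigroup +-commutativeSemigroup using (x∙yz≈y∙xz) renaming (interchange to +-interchange)
open import Data.Nat.Tactic.RingSolver using (solve-∀)
open import Data.Product using (Σ; ∃; ∃₂; _×_; _,_; proj₁)
open import Data.Sum using (_⊎_; inj₁; inj₂; [_,_]′)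
open import Data.Vec using (Vec; []; _∷_; lookup)
open import Function using (id; _∘_; _∘′_; flip)
open import Function.Bundles using (Equivalence)
open import Relation.Binary.PropositionalEquality hiding ([_])
open import Relation.Nullary using (Dec; yes; no; does; ¬?; _×-dec_; ofʸ; ofⁿ; contradiction)
open import Relation.Nullary.Decidable using (dec-true; dec-false)

open import Defs

𝟙 : Bool → ℕ
𝟙 true  = 1
𝟙 false = 0

𝟙-∧ : ∀ a b → 𝟙 (a ∧ b) ≡ 𝟙 a * 𝟙 b
𝟙-∧ true  b = sym (+-identityʳ (𝟙 b))
𝟙-∧ false b = refl

𝟙-not+𝟙 : ∀ b → 𝟙 (not b) + 𝟙 b ≡ 1
𝟙-not+𝟙 true  = refl
𝟙-not+𝟙 false = refl

∑< : ℕ → (ℕ → ℕ) → ℕ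
∑< zero    g = 0
∑< (suc n) g = g 0 + ∑< n (g ∘ suc)

∑<-cong : ∀ n {f g : ℕ → ℕ} → (∀ i → i < n → f i ≡ g i) → ∑< n f ≡ ∑< n g
∑<-cong zero    f≗g = refl
∑<-cong (suc n) f≗g = cong₂ _+_ (f≗g 0 z<s) (∑<-cong n (λ i i<n → f≗g (suc i) (s<s i<n)))

∑<-+ : ∀ a b g → ∑< (a + b) g ≡ ∑< a g + ∑< b (λ i → g (a + i))
∑<-+ zero    b g = refl
∑<-+ (suc a) b g = trans (cong (g 0 +_) (∑<-+ a b (g ∘ suc))) (sym (+-assoc (g 0) _ _))

∑<-const : ∀ n c → ∑< n (λ _ → c) ≡ n * c
∑<-const zero    c = refl
∑<-const (suc n) c = cong (c +_) (∑<-const n c)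

sum-map-allFin : ∀ n (g : ℕ → ℕ) → sum (map (g ∘ toℕ) (allFin n)) ≡ ∑< n g
sum-map-allFin n g = trans (cong sum (map-tabulate {n = n} id (g ∘ toℕ))) (sum-tabulate n g)
  where
  sum-tabulate : ∀ n (g : ℕ → ℕ) → sum (tabulate {n = n} (g ∘ toℕ)) ≡ ∑< n g
  sum-tabulate zero    g = refl
  sum-tabulate (suc n) g = cong (g 0 +_) (sum-tabulate n (g ∘ suc))

module _ {A : Set} where

  sum-map-cong : ∀ {f g : A → ℕ} (xs : List A) → (∀ x → f x ≡ g x) → sum (map f xs) ≡ sum (map g xs)
  sum-map-cong []       f≗g = refl
  sum-map-cong (x ∷ xs) f≗g = cong₂ _+_ (f≗g x) (sum-map-cong xs f≗g)

  sum-map-mono : ∀ {f g : A → ℕ} (xs : List A) → (∀ x → f x ≤ g x) → sum (map f xs) ≤ sum (map g xs)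
  sum-map-mono []       f≤g = z≤n
  sum-map-mono (x ∷ xs) f≤g = +-mono-≤ (f≤g x) (sum-map-mono xs f≤g)

  sum-map-0 : (xs : List A) → sum (map (λ _ → 0) xs) ≡ 0
  sum-map-0 []       = refl
  sum-map-0 (x ∷ xs) = sum-map-0 xs

  sum-map-+ : ∀ (f g : A → ℕ) xs → sum (map (λ x → f x + g x) xs) ≡ sum (map f xs) + sum (map g xs)
  sum-map-+ f g []       = refl
  sum-map-+ f g (x ∷ xs) = begin
    f x + g x + sum (map (λ x → f x + g x) xs)     ≡⟨ cong (f x + g x +_) (sum-map-+ f g xs) ⟩
    f x + g x + (sum (map f xs) + sum (map g xs)) ≡⟨ +-interchange (f x) (g x) _ _ ⟩
    f x + sum (map f xs) + (g x + sum (map g xs)) ∎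
    where open ≡-Reasoning

  sum-map-*ˡ : ∀ c (f : A → ℕ) xs → sum (map (λ x → c * f x) xs) ≡ c * sum (map f xs)
  sum-map-*ˡ c f []       = sym (*-zeroʳ c)
  sum-map-*ˡ c f (x ∷ xs) = trans (cong (c * f x +_) (sum-map-*ˡ c f xs)) (sym (*-distribˡ-+ c (f x) _))

module _ {A B : Set} where

  sum-map-comm : ∀ (h : A → B → ℕ) xs ys →
    sum (map (λ x → sum (map (h x) ys)) xs) ≡ sum (map (λ y → sum (map (λ x → h x y) xs)) ys)
  sum-map-comm h []       ys = sym (sum-map-0 ys)
  sum-map-comm h (x ∷ xs) ys = trans (cong (sum (map (h x) ys) +_) (sum-map-comm h xs ys))
    (sym (sum-map-+ (h x) (λ y → sum (map (λ x → h x y) xs)) ys))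

  sum-map-concatMap : ∀ (f : B → ℕ) (g : A → List B) xs →
    sum (map f (concatMap g xs)) ≡ sum (map (λ x → sum (map f (g x))) xs)
  sum-map-concatMap f g []       = refl
  sum-map-concatMap f g (x ∷ xs) = begin
    sum (map f (g x ++ concatMap g xs))                 ≡⟨ cong sum (map-++ f (g x) (concatMap g xs)) ⟩
    sum (map f (g x) ++ map f (concatMap g xs))         ≡⟨ sum-++ (map f (g x)) _ ⟩
    sum (map f (g x)) + sum (map f (concatMap g xs))    ≡⟨ cong (sum (map f (g x)) +_) (sum-map-concatMap f g xs) ⟩
    sum (map f (g x)) + sum (map (λ x → sum (map f (g x))) xs) ∎
    where open ≡-Reasoning

[m∸x]*[m+s+x]≤m*[m+s] : ∀ m x s → (m ∸ x) * (m + s + x) ≤ m * (m + s)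
[m∸x]*[m+s+x]≤m*[m+s] m x s with ≤-<-connex x m
... | inj₂ m<x rewrite m≤n⇒m∸n≡0 (<⇒≤ m<x) = z≤n
... | inj₁ x≤m = begin
  (m ∸ x) * (m + s + x)                 ≡⟨ *-distribˡ-+ (m ∸ x) (m + s) x ⟩
  (m ∸ x) * (m + s) + (m ∸ x) * x       ≤⟨ +-monoʳ-≤ _ (*-monoˡ-≤ x (≤-trans (m∸n≤m m x) (m≤m+n m s))) ⟩
  (m ∸ x) * (m + s) + (m + s) * x       ≡⟨ cong ((m ∸ x) * (m + s) +_) (*-comm (m + s) x) ⟩
  (m ∸ x) * (m + s) + x * (m + s)       ≡⟨ *-distribʳ-+ (m + s) (m ∸ x) x ⟨
  (m ∸ x + x) * (m + s)                 ≡⟨ cong (_* (m + s)) (m∸n+n≡m x≤m) ⟩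
  m * (m + s)                           ∎
  where open ≤-Reasoning

2*m≤[2+j]*[1+j]*m : ∀ j m → 2 * m ≤ (2 + j) * (1 + j) * m
2*m≤[2+j]*[1+j]*m j m = subst (2 * m ≤_) (sym (expand j m)) (m≤m+n (2 * m) _)
  where
  expand : ∀ j m → (2 + j) * (1 + j) * m ≡ 2 * m + (3 * j + j * j) * m
  expand = solve-∀

n*n*[2n+e]≤4*[n*[n∸1]*[n+e+1]] : ∀ j e →
  (2 + j) * (2 + j) * (2 * (2 + j) + e) ≤ 4 * ((2 + j) * (1 + j) * (1 + (2 + j) + e))
n*n*[2n+e]≤4*[n*[n∸1]*[n+e+1]] j e = subst ((2 + j) * (2 + j) * (2 * (2 + j) + e) ≤_) (sym (expand j e)) (m≤m+n _ _)
  where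
  expand : ∀ j e → 4 * ((2 + j) * (1 + j) * (1 + (2 + j) + e)) ≡
                   (2 + j) * (2 + j) * (2 * (2 + j) + e) + (2 + j) * (2 * j * j + 8 * j + 4 + 3 * j * e + 2 * e)
  expand = solve-∀

P*S≤G*[m+S]∧m≤S⇒P≤2*G : ∀ {P S G m} → m ≤ S → 0 < S → P * S ≤ G * (m + S) → P ≤ 2 * G
P*S≤G*[m+S]∧m≤S⇒P≤2*G {P} {S} {G} {m} m≤S 0<S P*S≤ = *-cancelʳ-≤ P (2 * G) S {{>-nonZero 0<S}} (begin
  P * S          ≤⟨ P*S≤ ⟩
  G * (m + S)    ≤⟨ *-monoʳ-≤ G (+-monoˡ-≤ S m≤S) ⟩
  G * (S + S)    ≡⟨ double G S ⟩
  2 * G * S      ∎)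
  where
  open ≤-Reasoning
  double : ∀ G S → G * (S + S) ≡ 2 * G * S
  double = solve-∀

P*S≤G*[m+S]∧S≤m⇒P*S≤2*m*G : ∀ {P S G m} → S ≤ m → P * S ≤ G * (m + S) → P * S ≤ 2 * m * G
P*S≤G*[m+S]∧S≤m⇒P*S≤2*m*G {P} {S} {G} {m} S≤m P*S≤ = begin
  P * S          ≤⟨ P*S≤ ⟩
  G * (m + S)    ≤⟨ *-monoʳ-≤ G (+-monoʳ-≤ m S≤m) ⟩
  G * (m + m)    ≡⟨ double G m ⟩
  2 * m * G      ∎
  where
  open ≤-Reasoning
  double : ∀ G m → G * (m + m) ≡ 2 * m * G
  double = solve-∀

-- Cyclic distance on ℤ/m

cdist : ℕ → ℕ → ℕ → ℕ
cdist m x y with x ≤? y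
... | yes _ = y ∸ x
... | no  _ = y + m ∸ x

cdist-≤ : ∀ m {x y} → x ≤ y → cdist m x y ≡ y ∸ x
cdist-≤ m {x} {y} x≤y with x ≤? y
... | yes _   = refl
... | no  x≰y = contradiction x≤y x≰y

cdist-> : ∀ m {x y} → y < x → cdist m x y ≡ y + m ∸ x
cdist-> m {x} {y} y<x with x ≤? y
... | yes x≤y = contradiction x≤y (<⇒≱ y<x)
... | no  _   = refl

+-cdist-% : ∀ m .{{_ : NonZero m}} x y → x < m → y < m → (x + cdist m x y) % m ≡ y
+-cdist-% m x y x<m y<m with ≤-<-connex x y
... | inj₁ x≤y rewrite cdist-≤ m x≤y | m+[n∸m]≡n x≤y = m<n⇒m%n≡m y<m
... | inj₂ y<x rewrite cdist-> m y<x | m+[n∸m]≡n (≤-trans (<⇒≤ x<m) (m≤n+m m y)) =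
  trans ([m+n]%n≡m%n y m) (m<n⇒m%n≡m y<m)

cdist-dichotomy : ∀ m {x y z} → x < m → y < m → z < m →
                  cdist m x y ≤ cdist m x z ⊎ cdist m y x ≤ cdist m y z
cdist-dichotomy m {x} {y} {z} x<m y<m z<m
  with ≤-<-connex x y | ≤-<-connex y z | ≤-<-connex x z
... | inj₁ x≤y | inj₁ y≤z | _ =
  inj₁ (subst₂ _≤_ (sym (cdist-≤ m x≤y)) (sym (cdist-≤ m (≤-trans x≤y y≤z))) (∸-monoˡ-≤ x y≤z))
... | inj₁ x≤y | inj₂ z<y | inj₁ x≤z =
  inj₂ (subst₂ _≤_ (sym (cdist-> m (≤-<-trans x≤z z<y))) (sym (cdist-> m z<y)) (∸-monoˡ-≤ y (+-monoˡ-≤ m x≤z)))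
... | inj₁ x≤y | inj₂ z<y | inj₂ z<x =
  inj₁ (subst₂ _≤_ (sym (cdist-≤ m x≤y)) (sym (cdist-> m z<x)) (∸-monoˡ-≤ x (≤-trans (<⇒≤ y<m) (m≤n+m m z))))
... | inj₂ y<x | inj₁ y≤z | inj₁ x≤z =
  inj₂ (subst₂ _≤_ (sym (cdist-≤ m (<⇒≤ y<x))) (sym (cdist-≤ m y≤z)) (∸-monoˡ-≤ y x≤z))
... | inj₂ y<x | inj₁ y≤z | inj₂ z<x =
  inj₁ (subst₂ _≤_ (sym (cdist-> m y<x)) (sym (cdist-> m z<x)) (∸-monoˡ-≤ x (+-monoˡ-≤ m y≤z)))
... | inj₂ y<x | inj₂ z<y | _ =
  inj₂ (subst₂ _≤_ (sym (cdist-≤ m (<⇒≤ y<x))) (sym (cdist-> m z<y)) (∸-monoˡ-≤ y (≤-trans (<⇒≤ x<m) (m≤n+m m z))))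

∑<-𝟙-≤? : ∀ m K → K < m → ∑< m (λ e → 𝟙 (does (e ≤? K))) ≡ suc K
∑<-𝟙-≤? m K K<m = begin
  ∑< m h                                                  ≡⟨ cong (λ l → ∑< l h) (sym (m+[n∸m]≡n K<m)) ⟩
  ∑< (suc K + (m ∸ suc K)) h                              ≡⟨ ∑<-+ (suc K) (m ∸ suc K) h ⟩
  ∑< (suc K) h + ∑< (m ∸ suc K) (λ i → h (suc K + i))     ≡⟨ cong₂ _+_ below above ⟩
  suc K + 0                                               ≡⟨ +-identityʳ (suc K) ⟩
  suc K                                                   ∎
  where
  open ≡-Reasoning
  h : ℕ → ℕ
  h e = 𝟙 (does (e ≤? K))
  below : ∑< (suc K) h ≡ suc K
  below = trans (∑<-cong (suc K) (λ i i≤K → cong 𝟙 (dec-true (i ≤? K) (s≤s⁻¹ i≤K))))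
                (trans (∑<-const (suc K) 1) (*-identityʳ (suc K)))
  above : ∑< (m ∸ suc K) (λ i → h (suc K + i)) ≡ 0
  above = trans (∑<-cong (m ∸ suc K) (λ i _ → cong 𝟙 (dec-false (suc K + i ≤? K) (<⇒≱ (s≤s (m≤m+n K i))))))
                (trans (∑<-const (m ∸ suc K) 0) (*-zeroʳ (m ∸ suc K)))

∑<-𝟙-cdist≤? : ∀ m K b → b < m → K < m → ∑< m (λ a → 𝟙 (does (cdist m b a ≤? K))) ≡ suc K
∑<-𝟙-cdist≤? m K b b<m K<m = begin
  ∑< m f                                                  ≡⟨ cong (λ l → ∑< l f) (sym (m+[n∸m]≡n (<⇒≤ b<m))) ⟩
  ∑< (b + (m ∸ b)) f                                      ≡⟨ ∑<-+ b (m ∸ b) f ⟩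
  ∑< b f + ∑< (m ∸ b) (λ i → f (b + i))                   ≡⟨ cong₂ _+_ (∑<-cong b before) (∑<-cong (m ∸ b) after) ⟩
  ∑< b (λ a → h (m ∸ b + a)) + ∑< (m ∸ b) h               ≡⟨ +-comm _ (∑< (m ∸ b) h) ⟩
  ∑< (m ∸ b) h + ∑< b (λ a → h (m ∸ b + a))               ≡⟨ sym (∑<-+ (m ∸ b) b h) ⟩
  ∑< (m ∸ b + b) h                                        ≡⟨ cong (λ l → ∑< l h) (m∸n+n≡m (<⇒≤ b<m)) ⟩
  ∑< m h                                                  ≡⟨ ∑<-𝟙-≤? m K K<m ⟩
  suc K                                                   ∎
  where
  open ≡-Reasoning
  h : ℕ → ℕ
  h e = 𝟙 (does (e ≤? K))
  f : ℕ → ℕ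
  f a = h (cdist m b a)
  before : ∀ a → a < b → f a ≡ h (m ∸ b + a)
  before a a<b = cong h (trans (cdist-> m a<b) (trans (+-∸-assoc a (<⇒≤ b<m)) (+-comm a (m ∸ b))))
  after : ∀ i → i < m ∸ b → f (b + i) ≡ h i
  after i _ = cong h (trans (cdist-≤ m (m≤m+n b i)) (m+n∸m≡n b i))

-- Configurations of starting points with no close pair

module Separation (m K : ℕ) where

  Close : Fin m → Fin m → Set
  Close a b = cdist m (toℕ a) (toℕ b) ≤ K

  -- Opaque so that `with close? a b` can abstract it: unfolded, `does (close? a b)` normalises
  -- to a `≤ᵇ` test that no longer mentions `close? a b`.
  opaque
    close? : ∀ a b → Dec (Close a b)
    close? a b = cdist m (toℕ a) (toℕ b) ≤? K

    close?-unfold : ∀ a b → close? a b ≡ (cdist m (toℕ a) (toℕ b) ≤? K)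
    close?-unfold a b = refl

  apart : ∀ {k} → Fin m → Vec (Fin m) k → Bool
  apart a []      = true
  apart a (b ∷ v) = not (does (close? b a)) ∧ not (does (close? a b)) ∧ apart a v

  spread : ∀ {k} → Vec (Fin m) k → Bool
  spread []      = true
  spread (a ∷ v) = apart a v ∧ spread v

  #behind : ∀ {k} → Fin m → Vec (Fin m) k → ℕ
  #behind a []      = 0
  #behind a (b ∷ v) = 𝟙 (does (close? b a)) + #behind a v

  close-dichotomy : ∀ {a b b′} → Close b a → Close b′ a → Close b b′ ⊎ Close b′ b
  close-dichotomy {a} {b} {b′} ba b′a
    with cdist-dichotomy m (toℕ<n b) (toℕ<n b′) (toℕ<n a)
  ... | inj₁ bb′≤ba  = inj₁ (≤-trans bb′≤ba ba)
  ... | inj₂ b′b≤b′a = inj₂ (≤-trans b′b≤b′a b′a)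

  #behind-close : ∀ {k} b a (v : Vec (Fin m) k) → T (apart b v) → Close b a → #behind a v ≡ 0
  #behind-close b a []       _  _  = refl
  #behind-close b a (b′ ∷ v) ap ba with close? b′ b | close? b b′
  ... | no b′≁b | no b≁b′ with close? b′ a
  ...   | no _    = #behind-close b a v ap ba
  ...   | yes b′a = ⊥-elim ([ b≁b′ , b′≁b ]′ (close-dichotomy {a} {b} {b′} ba b′a))

  𝟙-apart+#behind≤1 : ∀ {k} a (v : Vec (Fin m) k) → T (spread v) → 𝟙 (apart a v) + #behind a v ≤ 1
  𝟙-apart+#behind≤1 a []      _ = ≤-refl
  𝟙-apart+#behind≤1 a (b ∷ v) sp with close? b a | Equivalence.to (T-∧ {apart b v}) sp
  ... | yes ba | bv , _ rewrite #behind-close b a v bv ba = ≤-refl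
  ... | no _   | _ , sv with close? a b
  ...   | no _  = 𝟙-apart+#behind≤1 a v sv
  ...   | yes _ = m+n≤o⇒n≤o (𝟙 (apart a v)) (𝟙-apart+#behind≤1 a v sv)

  not-apart : ∀ {k} a (v : Vec (Fin m) k) → apart a v ≡ false → ∃ λ q → Close (lookup v q) a ⊎ Close a (lookup v q)
  not-apart a (b ∷ v) ¬ap with close? b a | close? a b
  ... | yes ba | _      = Fin.zero , inj₁ ba
  ... | no _   | yes ab = Fin.zero , inj₂ ab
  ... | no _   | no _   with not-apart a v ¬ap
  ...   | q , c = Fin.suc q , c

  close-pair : ∀ {k} (v : Vec (Fin m) k) → spread v ≡ false →
               ∃₂ λ p q → p ≢ q × Close (lookup v p) (lookup v q)
  close-pair (a ∷ v) ¬sp with apart a v in ap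
  ... | false with not-apart a v ap
  ...   | q , inj₁ qa = Fin.suc q , Fin.zero , (λ ()) , qa
  ...   | q , inj₂ aq = Fin.zero , Fin.suc q , (λ ()) , aq
  close-pair (a ∷ v) ¬sp | true with close-pair v ¬sp
  ...   | p , q , p≢q , pq = Fin.suc p , Fin.suc q , p≢q ∘ Fin-suc-injective , pq

  ∑ : (Fin m → ℕ) → ℕ
  ∑ f = sum (map f (allFin m))

  ∑-#behind : K < m → ∀ {k} (v : Vec (Fin m) k) → ∑ (λ a → #behind a v) ≡ k * suc K
  ∑-#behind K<m []      = sum-map-0 (allFin m)
  ∑-#behind K<m (b ∷ v) = trans (sum-map-+ (λ a → 𝟙 (does (close? b a))) (λ a → #behind a v) (allFin m))
    (cong₂ _+_ window (∑-#behind K<m v))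
    where
    window : ∑ (λ a → 𝟙 (does (close? b a))) ≡ suc K
    window = begin
      ∑ (λ a → 𝟙 (does (close? b a)))
        ≡⟨ sum-map-cong (allFin m) (cong (𝟙 ∘ does) ∘ close?-unfold b) ⟩
      sum (map (λ a → 𝟙 (does (cdist m (toℕ b) (toℕ a) ≤? K))) (allFin m))
        ≡⟨ sum-map-allFin m (λ a → 𝟙 (does (cdist m (toℕ b) a ≤? K))) ⟩
      ∑< m (λ a → 𝟙 (does (cdist m (toℕ b) a ≤? K)))
        ≡⟨ ∑<-𝟙-cdist≤? m K (toℕ b) (toℕ<n b) K<m ⟩
      suc K ∎
      where open ≡-Reasoning

  ∑-𝟙 : ∑ (λ _ → 1) ≡ m
  ∑-𝟙 = trans (sum-map-allFin m (λ _ → 1)) (trans (∑<-const m 1) (*-identityʳ m))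

  ∑-apart+k[K+1]≤m : K < m → ∀ {k} (v : Vec (Fin m) k) → T (spread v) →
                     ∑ (λ a → 𝟙 (apart a v)) + k * suc K ≤ m
  ∑-apart+k[K+1]≤m K<m {k} v sv = begin
    ∑ (λ a → 𝟙 (apart a v)) + k * suc K               ≡⟨ cong (∑ (λ a → 𝟙 (apart a v)) +_) (∑-#behind K<m v) ⟨
    ∑ (λ a → 𝟙 (apart a v)) + ∑ (λ a → #behind a v)   ≡⟨ sum-map-+ (𝟙 ∘ flip apart v) (flip #behind v) (allFin m) ⟨
    ∑ (λ a → 𝟙 (apart a v) + #behind a v)             ≤⟨ sum-map-mono (allFin m) (λ a → 𝟙-apart+#behind≤1 a v sv) ⟩
    ∑ (λ _ → 1)                                       ≡⟨ ∑-𝟙 ⟩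
    m                                                 ∎
    where open ≤-Reasoning

  sum-allVecs-suc : ∀ n (F : Vec (Fin m) (suc n) → ℕ) →
                    sum (map F (allVecs {m} (suc n))) ≡ ∑ (λ a → sum (map (F ∘ (a ∷_)) (allVecs {m} n)))
  sum-allVecs-suc n F = trans (sum-map-concatMap F (λ a → map (a ∷_) (allVecs n)) (allFin m))
    (sum-map-cong (allFin m) (λ a → cong sum (sym (map-∘ (allVecs n)))))

  sum-allVecs-1 : ∀ n → sum (map (λ _ → 1) (allVecs {m} n)) ≡ m ^ n
  sum-allVecs-1 zero    = refl
  sum-allVecs-1 (suc n) = begin
    sum (map (λ _ → 1) (allVecs {m} (suc n)))       ≡⟨ sum-allVecs-suc n (λ _ → 1) ⟩
    ∑ (λ _ → sum (map (λ _ → 1) (allVecs {m} n)))   ≡⟨ sum-map-cong (allFin m) (λ _ → sum-allVecs-1 n) ⟩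
    ∑ (λ _ → m ^ n)                                 ≡⟨ sum-map-allFin m (λ _ → m ^ n) ⟩
    ∑< m (λ _ → m ^ n)                              ≡⟨ ∑<-const m (m ^ n) ⟩
    m ^ suc n                                       ∎
    where open ≡-Reasoning

  #spread : ℕ → ℕ
  #spread n = sum (map (𝟙 ∘ spread) (allVecs {m} n))

  #unspread : ℕ → ℕ
  #unspread n = sum (map (𝟙 ∘ not ∘ spread) (allVecs {m} n))

  #unspread+#spread : ∀ n → #unspread n + #spread n ≡ m ^ n
  #unspread+#spread n = begin
    #unspread n + #spread n
      ≡⟨ sum-map-+ (𝟙 ∘ not ∘ spread) (𝟙 ∘ spread) (allVecs n) ⟨
    sum (map (λ v → 𝟙 (not (spread v)) + 𝟙 (spread v)) (allVecs n))
      ≡⟨ sum-map-cong (allVecs n) (𝟙-not+𝟙 ∘ spread) ⟩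
    sum (map (λ _ → 1) (allVecs {m} n))
      ≡⟨ sum-allVecs-1 n ⟩
    m ^ n ∎
    where open ≡-Reasoning

  S : ℕ → ℕ
  S zero    = 0
  S (suc n) = S n + n * suc K

  2*S : ∀ k → 2 * S (suc k) ≡ suc k * k * suc K
  2*S zero    = refl
  2*S (suc k) = begin
    2 * (S (suc k) + suc k * suc K)            ≡⟨ *-distribˡ-+ 2 (S (suc k)) _ ⟩
    2 * S (suc k) + 2 * (suc k * suc K)        ≡⟨ cong (_+ 2 * (suc k * suc K)) (2*S k) ⟩
    suc k * k * suc K + 2 * (suc k * suc K)    ≡⟨ expand k (suc K) ⟩
    suc (suc k) * suc k * suc K                ∎
    where
    open ≡-Reasoning
    expand : ∀ k t → suc k * k * t + 2 * (suc k * t) ≡ suc (suc k) * suc k * t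
    expand = solve-∀

  module _ (K<m : K < m) where

    #spread-suc : ∀ n → #spread (suc n) ≤ (m ∸ n * suc K) * #spread n
    #spread-suc n = begin
      #spread (suc n)
        ≡⟨ sum-allVecs-suc n (𝟙 ∘ spread) ⟩
      ∑ (λ a → sum (map (λ v → 𝟙 (apart a v ∧ spread v)) vs))
        ≡⟨ sum-map-cong (allFin m) (λ a → sum-map-cong vs (reorder a)) ⟩
      ∑ (λ a → sum (map (λ v → 𝟙 (spread v) * 𝟙 (apart a v)) vs))
        ≡⟨ sum-map-comm (λ a v → 𝟙 (spread v) * 𝟙 (apart a v)) (allFin m) vs ⟩
      sum (map (λ v → ∑ (λ a → 𝟙 (spread v) * 𝟙 (apart a v))) vs)
        ≡⟨ sum-map-cong vs (λ v → sum-map-*ˡ (𝟙 (spread v)) (λ a → 𝟙 (apart a v)) (allFin m)) ⟩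
      sum (map (λ v → 𝟙 (spread v) * ∑ (λ a → 𝟙 (apart a v))) vs)
        ≤⟨ sum-map-mono vs extensions ⟩
      sum (map (λ v → (m ∸ n * suc K) * 𝟙 (spread v)) vs)
        ≡⟨ sum-map-*ˡ (m ∸ n * suc K) (𝟙 ∘ spread) vs ⟩
      (m ∸ n * suc K) * #spread n ∎
      where
      open ≤-Reasoning
      vs : List (Vec (Fin m) n)
      vs = allVecs {m} n
      reorder : ∀ a v → 𝟙 (apart a v ∧ spread v) ≡ 𝟙 (spread v) * 𝟙 (apart a v)
      reorder a v = trans (𝟙-∧ (apart a v) (spread v)) (*-comm (𝟙 (apart a v)) (𝟙 (spread v)))
      extensions : ∀ v → 𝟙 (spread v) * ∑ (λ a → 𝟙 (apart a v)) ≤ (m ∸ n * suc K) * 𝟙 (spread v)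
      extensions v with spread v in sv
      ... | false = z≤n
      ... | true  = subst₂ _≤_ (sym (+-identityʳ _)) (sym (*-identityʳ _))
                      (m+n≤o⇒m≤o∸n _ (∑-apart+k[K+1]≤m K<m v (subst T (sym sv) _)))

    #spread*[m+S]≤m^n*m : ∀ n → #spread n * (m + S n) ≤ m ^ n * m
    #spread*[m+S]≤m^n*m zero    = ≤-reflexive (+-identityʳ (m + 0))
    #spread*[m+S]≤m^n*m (suc n) = begin
      #spread (suc n) * (m + (S n + x))              ≡⟨ cong (#spread (suc n) *_) (+-assoc m (S n) x) ⟨
      #spread (suc n) * (m + S n + x)                ≤⟨ *-monoˡ-≤ (m + S n + x) (#spread-suc n) ⟩
      (m ∸ x) * #spread n * (m + S n + x)            ≡⟨ cong (_* (m + S n + x)) (*-comm (m ∸ x) (#spread n)) ⟩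
      #spread n * (m ∸ x) * (m + S n + x)            ≡⟨ *-assoc (#spread n) (m ∸ x) (m + S n + x) ⟩
      #spread n * ((m ∸ x) * (m + S n + x))          ≤⟨ *-monoʳ-≤ (#spread n) ([m∸x]*[m+s+x]≤m*[m+s] m x (S n)) ⟩
      #spread n * (m * (m + S n))                    ≡⟨ cong (#spread n *_) (*-comm m (m + S n)) ⟩
      #spread n * ((m + S n) * m)                    ≡⟨ *-assoc (#spread n) (m + S n) m ⟨
      #spread n * (m + S n) * m                      ≤⟨ *-monoˡ-≤ m (#spread*[m+S]≤m^n*m n) ⟩
      m ^ n * m * m                                  ≡⟨ cong (_* m) (*-comm (m ^ n) m) ⟩
      m ^ suc n * m                                  ∎
      where
      open ≤-Reasoning
      x : ℕ
      x = n * suc K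

    m^n*S≤#unspread*[m+S] : ∀ n → m ^ n * S n ≤ #unspread n * (m + S n)
    m^n*S≤#unspread*[m+S] n = +-cancelˡ-≤ (m ^ n * m) _ _ (begin
      m ^ n * m + m ^ n * S n                              ≡⟨ *-distribˡ-+ (m ^ n) m (S n) ⟨
      m ^ n * (m + S n)                                    ≡⟨ cong (_* (m + S n)) (#unspread+#spread n) ⟨
      (#unspread n + #spread n) * (m + S n)                ≡⟨ *-distribʳ-+ (m + S n) (#unspread n) (#spread n) ⟩
      #unspread n * (m + S n) + #spread n * (m + S n)      ≤⟨ +-monoʳ-≤ _ (#spread*[m+S]≤m^n*m n) ⟩
      #unspread n * (m + S n) + m ^ n * m                  ≡⟨ +-comm _ (m ^ n * m) ⟩
      m ^ n * m + #unspread n * (m + S n)                  ∎)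
      where open ≤-Reasoning

module _ {A : Set} where

  insertAt : ℕ → A → List A → List A
  insertAt i x xs = take i xs ++ x ∷ drop i xs

  length-insertAt : ∀ i x xs → length (insertAt i x xs) ≡ suc (length xs)
  length-insertAt i x xs = begin
    length (take i xs ++ x ∷ drop i xs)            ≡⟨ length-++ (take i xs) ⟩
    length (take i xs) + suc (length (drop i xs))  ≡⟨ +-suc _ _ ⟩
    suc (length (take i xs) + length (drop i xs))  ≡⟨ cong suc (length-++ (take i xs)) ⟨
    suc (length (take i xs ++ drop i xs))          ≡⟨ cong (suc ∘′ length) (take++drop≡id i xs) ⟩
    suc (length xs)                                ∎
    where open ≡-Reasoning

  All-insertAt : ∀ {P : A → Set} i {x xs} → P x → All P xs → All P (insertAt i x xs)
  All-insertAt i px pxs = ++⁺ (take⁺ i pxs) (px ∷ drop⁺ i pxs)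

sum-insertAt : ∀ i x xs → sum (insertAt i x xs) ≡ x + sum xs
sum-insertAt i x xs = begin
  sum (take i xs ++ x ∷ drop i xs)          ≡⟨ sum-++ (take i xs) _ ⟩
  sum (take i xs) + (x + sum (drop i xs))   ≡⟨ x∙yz≈y∙xz (sum (take i xs)) x _ ⟩
  x + (sum (take i xs) + sum (drop i xs))   ≡⟨ cong (x +_) (sum-++ (take i xs) _) ⟨
  x + sum (take i xs ++ drop i xs)          ≡⟨ cong ((x +_) ∘′ sum) (take++drop≡id i xs) ⟩
  x + sum xs                                ∎
  where open ≡-Reasoning

lookupD-insertAt : ∀ i x xs → i ≤ length xs → lookupD (insertAt i x xs) i ≡ just x
lookupD-insertAt zero    x xs       _         = refl
lookupD-insertAt (suc i) x (y ∷ xs) (s≤s i≤n) = lookupD-insertAt i x xs i≤n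

lookupD-incr : ∀ D j {c} → lookupD D j ≡ just c → lookupD (incr D j) j ≡ just (suc c)
lookupD-incr (x ∷ D) zero    refl   = refl
lookupD-incr (x ∷ D) (suc j) D[j]≡c = lookupD-incr D j D[j]≡c

lookupD-incr-≢ : ∀ D {j j′} → j ≢ j′ → lookupD (incr D j′) j ≡ lookupD D j
lookupD-incr-≢ []      {_}     {_}      _    = refl
lookupD-incr-≢ (x ∷ D) {zero}  {zero}   j≢j′ = contradiction refl j≢j′
lookupD-incr-≢ (x ∷ D) {zero}  {suc j′} _    = refl
lookupD-incr-≢ (x ∷ D) {suc j} {zero}   _    = refl
lookupD-incr-≢ (x ∷ D) {suc j} {suc j′} j≢j′ = lookupD-incr-≢ D (j≢j′ ∘′ cong suc)

lookupD-∷ʳ : ∀ D x j {e} → lookupD (D ++ [ x ]) j ≡ just e → lookupD D j ≡ just e ⊎ (j ≡ length D × e ≡ x)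
lookupD-∷ʳ []      x zero    refl   = inj₂ (refl , refl)
lookupD-∷ʳ (y ∷ D) x zero    D[0]≡e = inj₁ D[0]≡e
lookupD-∷ʳ (y ∷ D) x (suc j) D[j]≡e with lookupD-∷ʳ D x j D[j]≡e
... | inj₁ D[j]≡e′      = inj₁ D[j]≡e′
... | inj₂ (refl , x≡e) = inj₂ (refl , x≡e)

lookupD-++-∷ : ∀ A c B → lookupD (A ++ c ∷ B) (length A) ≡ just c
lookupD-++-∷ []      c B = refl
lookupD-++-∷ (x ∷ A) c B = lookupD-++-∷ A c B

incr-++-∷ : ∀ A c B → incr (A ++ c ∷ B) (length A) ≡ A ++ suc c ∷ B
incr-++-∷ []      c B = refl
incr-++-∷ (x ∷ A) c B = cong (x ∷_) (incr-++-∷ A c B)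

lookupD-replicate : ∀ {k j} x → j < k → lookupD (replicate k x) j ≡ just x
lookupD-replicate {suc k} {zero}  x _         = refl
lookupD-replicate {suc k} {suc j} x (s≤s j<k) = lookupD-replicate x j<k

drop-suc : ∀ {A : Set} k (xs : List A) {x rest} → drop k xs ≡ x ∷ rest → drop (suc k) xs ≡ rest
drop-suc zero    (y ∷ xs) refl = refl
drop-suc (suc k) (y ∷ xs) eq   = drop-suc k xs eq

drop-++ : ∀ {A : Set} (xs ys : List A) → drop (length xs) (xs ++ ys) ≡ ys
drop-++ []       ys = refl
drop-++ (x ∷ xs) ys = drop-++ xs ys

replicate-∷ʳ : ∀ {A : Set} k (x : A) → replicate k x ++ [ x ] ≡ replicate (suc k) x
replicate-∷ʳ zero    x = refl
replicate-∷ʳ (suc k) x = cong (x ∷_) (replicate-∷ʳ k x)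

-- The adversary

module Strategy (m n d : ℕ) where

  M : ℕ
  M = m ∸ 1

  R : ℕ
  R = d ∸ n

  -- The leader's K + 1 IDs cover every start within K steps after its own; K ≤ d − n leaves one
  -- request for every other instance, and K < m keeps each demand at most m.
  K : ℕ
  K = R ℕ.⊓ M

  open Separation m K using (Close; close?)

  Follows : ℕ × Fin m → ℕ × Fin m → Set
  Follows (i , a) (j , b) = i ≢ j × Close a b

  follows? : ∀ e e′ → Dec (Follows e e′)
  follows? (i , a) (j , b) = ¬? (i ≟ j) ×-dec close? a b

  leader : History m → ℕ
  leader h with any? (λ e → any? (follows? e) h) h
  ... | yes p = proj₁ (proj₁ (find p))
  ... | no  _ = 0

  leader-spec : ∀ h → Any (λ e → Any (Follows e) h) h →
                ∃ λ a → (leader h , a) ∈ h × Any (Follows (leader h , a)) h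
  leader-spec h has-follower with any? (λ e → any? (follows? e) h) h
  ... | yes p = let (_ , a) , e∈h , follower = find p in a , e∈h , follower
  ... | no ¬p = contradiction has-follower ¬p

  fill : ℕ → ℕ → List ℕ
  fill b zero    = []
  fill b (suc k) = suc (b ℕ.⊓ M) ∷ fill (b ∸ M) k

  profile : ℕ → List ℕ
  profile i = insertAt i (suc K) (fill (R ∸ K) (n ∸ 1))

  script : List ℕ → ℕ → List ℕ
  script []      j = []
  script (f ∷ F) j = replicate (f ∸ 1) j ++ script F (suc j)

  nextRequest : List ℕ → Action
  nextRequest []      = stop
  nextRequest (j ∷ _) = request j

  -- Histories list the most recent answer first, so `drop k h` holds the answers to the activations.
  adversary : Adversary m
  adversary h = if length h <ᵇ n then activate else nextRequest (drop k (script (profile (leader (drop k h))) 0))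
    where
    k : ℕ
    k = length h ∸ n

  Demand : ℕ → Set
  Demand x = 1 ≤ x × x ≤ m

  length-fill : ∀ b k → length (fill b k) ≡ k
  length-fill b zero    = refl
  length-fill b (suc k) = cong suc (length-fill (b ∸ M) k)

  sum-fill : ∀ b k → b ≤ k * M → sum (fill b k) ≡ k + b
  sum-fill b zero    b≤0   = sym (n≤0⇒n≡0 b≤0)
  sum-fill b (suc k) b≤kM = begin
    suc (b ℕ.⊓ M) + sum (fill (b ∸ M) k)  ≡⟨ cong (suc (b ℕ.⊓ M) +_) (sum-fill (b ∸ M) k (m≤n+o⇒m∸n≤o b M b≤kM)) ⟩
    suc (b ℕ.⊓ M) + (k + (b ∸ M))         ≡⟨ cong suc (x∙yz≈y∙xz (b ℕ.⊓ M) k (b ∸ M)) ⟩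
    suc (k + (b ℕ.⊓ M + (b ∸ M)))         ≡⟨ cong (λ l → suc (k + (l + (b ∸ M)))) (⊓-comm b M) ⟩
    suc (k + (M ℕ.⊓ b + (b ∸ M)))         ≡⟨ cong (λ l → suc (k + l)) (m⊓n+n∸m≡n M b) ⟩
    suc k + b                             ∎
    where open ≡-Reasoning

  length-script : ∀ F j → All Demand F → length (script F j) + length F ≡ sum F
  length-script []      j _                    = refl
  length-script (f ∷ F) j ((1≤f , _) ∷ demands) = begin
    length (replicate (f ∸ 1) j ++ script F (suc j)) + suc (length F)
      ≡⟨ cong (_+ suc (length F)) (trans (length-++ (replicate (f ∸ 1) j)) (cong (_+ _) (length-replicate (f ∸ 1)))) ⟩
    f ∸ 1 + length (script F (suc j)) + suc (length F)
      ≡⟨ regroup (f ∸ 1) (length (script F (suc j))) (length F) ⟩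
    suc (f ∸ 1) + (length (script F (suc j)) + length F)
      ≡⟨ cong₂ _+_ (m+[n∸m]≡n 1≤f) (length-script F (suc j) demands) ⟩
    f + sum F ∎
    where
    open ≡-Reasoning
    regroup : ∀ a b c → a + b + suc c ≡ suc a + (b + c)
    regroup = solve-∀

  lookupD-profile : ∀ {i} → i < n → lookupD (profile i) i ≡ just (suc K)
  lookupD-profile {i} i<n =
    lookupD-insertAt i (suc K) _ (subst (i ≤_) (sym (length-fill (R ∸ K) (n ∸ 1))) (∸-monoˡ-≤ 1 i<n))

  module _ (0<m : 0 < m) where

    suc-M : suc M ≡ m
    suc-M = m+[n∸m]≡n 0<m

    K<m : K < m
    K<m = ≤-<-trans (m⊓n≤n R M) (subst (M <_) suc-M ≤-refl)

    All-fill : ∀ b k → All Demand (fill b k)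
    All-fill b zero    = []
    All-fill b (suc k) = (s≤s z≤n , subst (suc (b ℕ.⊓ M) ≤_) suc-M (s≤s (m⊓n≤n b M))) ∷ All-fill (b ∸ M) k

    module _ (n≥1 : 1 ≤ n) (n≤d : n ≤ d) (d≤nm : d ≤ n * m) where

      suc-n∸1 : suc (n ∸ 1) ≡ n
      suc-n∸1 = m+[n∸m]≡n n≥1

      length-profile : ∀ i → length (profile i) ≡ n
      length-profile i = trans (length-insertAt i (suc K) _) (trans (cong suc (length-fill (R ∸ K) (n ∸ 1))) suc-n∸1)

      All-profile : ∀ i → All Demand (profile i)
      All-profile i = All-insertAt i (s≤s z≤n , subst (suc K ≤_) suc-M (s≤s (m⊓n≤n R M))) (All-fill (R ∸ K) (n ∸ 1))

      R∸K≤[n∸1]*M : R ∸ K ≤ (n ∸ 1) * M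
      R∸K≤[n∸1]*M with ≤-<-connex R M
      ... | inj₁ R≤M rewrite m≤n⇒m⊓n≡m R≤M | n∸n≡0 R = z≤n
      ... | inj₂ M<R rewrite m≥n⇒m⊓n≡n (<⇒≤ M<R) = m≤n+o⇒m∸n≤o R M (begin
        R              ≤⟨ ∸-monoˡ-≤ n d≤nm ⟩
        n * m ∸ n      ≡⟨ cong (n * m ∸_) (*-identityʳ n) ⟨
        n * m ∸ n * 1  ≡⟨ *-distribˡ-∸ n m 1 ⟨
        n * M          ≡⟨ cong (_* M) suc-n∸1 ⟨
        suc (n ∸ 1) * M ∎)
        where open ≤-Reasoning

      sum-profile : ∀ i → sum (profile i) ≡ d
      sum-profile i = begin
        sum (profile i)                      ≡⟨ sum-insertAt i (suc K) _ ⟩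
        suc K + sum (fill (R ∸ K) (n ∸ 1))   ≡⟨ cong (suc K +_) (sum-fill (R ∸ K) (n ∸ 1) R∸K≤[n∸1]*M) ⟩
        suc K + (n ∸ 1 + (R ∸ K))            ≡⟨ regroup K (n ∸ 1) (R ∸ K) ⟩
        suc (n ∸ 1) + (K + (R ∸ K))          ≡⟨ cong₂ _+_ suc-n∸1 (m+[n∸m]≡n (m⊓n≤m R M)) ⟩
        n + (d ∸ n)                          ≡⟨ m+[n∸m]≡n n≤d ⟩
        d                                    ∎
        where
        open ≡-Reasoning
        regroup : ∀ x y z → suc x + (y + z) ≡ suc y + (x + z)
        regroup = solve-∀

      suc-d : ∀ i → suc d ≡ n + (length (script (profile i) 0) + 1)
      suc-d i = begin
        suc d                                        ≡⟨ cong suc (sum-profile i) ⟨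
        suc (sum (profile i))                        ≡⟨ cong suc (length-script (profile i) 0 (All-profile i)) ⟨
        suc (length plan + length (profile i))       ≡⟨ cong (λ l → suc (length plan + l)) (length-profile i) ⟩
        suc (length plan + n)                        ≡⟨ regroup (length plan) n ⟩
        n + (length plan + 1)                        ∎
        where
        open ≡-Reasoning
        plan : List ℕ
        plan = script (profile i) 0
        regroup : ∀ x y → suc (x + y) ≡ y + (x + 1)
        regroup = solve-∀

module _ {m n : ℕ} (Z : Adversary m) (π : Fin n → Fin m → Fin m) where

  run-stop : ∀ f D h → Z h ≡ stop → run Z π (suc f) D h ≡ just (D , h)
  run-stop f D h Zh≡stop rewrite Zh≡stop = refl

  run-activate : ∀ f D h → Z h ≡ activate → (k<n : length D < n) (0<m : 0 < m) →
                 run Z π (suc f) D h ≡ run Z π f (D ++ [ 1 ]) ((length D , π (fromℕ< k<n) (fromℕ< 0<m)) ∷ h)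
  run-activate f D h Zh≡act k<n 0<m rewrite Zh≡act with length D <? n | 0 <? m
  ... | yes _   | yes _   = refl
  ... | no k≮n  | _       = contradiction k<n k≮n
  ... | yes _   | no 0≮m  = contradiction 0<m 0≮m

  run-request : ∀ f D h j c → Z h ≡ request j → lookupD D j ≡ just c → (j<n : j < n) (c<m : c < m) →
                run Z π (suc f) D h ≡ run Z π f (incr D j) ((j , π (fromℕ< j<n) (fromℕ< c<m)) ∷ h)
  run-request f D h j c Zh≡req D[j]≡c j<n c<m rewrite Zh≡req | D[j]≡c with j <? n | c <? m
  ... | yes _  | yes _  = refl
  ... | no j≮n | _      = contradiction j<n j≮n
  ... | yes _  | no c≮m = contradiction c<m c≮m

module _ {m n : ℕ} (π : Fin n → Fin m → Fin m) where

  Recorded : List ℕ → History m → Set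
  Recorded D h = ∀ j c (j<n : j < n) (c<m : c < m) {e} → lookupD D j ≡ just e → c < e →
                 (j , π (fromℕ< j<n) (fromℕ< c<m)) ∈ h

  Recorded-[] : Recorded [] []
  Recorded-[] j c j<n c<m ()

  Recorded-request : ∀ {D h j c} → lookupD D j ≡ just c → (j<n : j < n) (c<m : c < m) → Recorded D h →
                     Recorded (incr D j) ((j , π (fromℕ< j<n) (fromℕ< c<m)) ∷ h)
  Recorded-request {D} {h} {j₀} {c₀} D[j₀]≡c₀ j₀<n c₀<m rec j c j<n c<m D′[j]≡e c<e with j ≟ j₀
  ... | no j≢j₀  = there (rec j c j<n c<m (trans (sym (lookupD-incr-≢ D j≢j₀)) D′[j]≡e) c<e)
  ... | yes refl with trans (sym D′[j]≡e) (lookupD-incr D j₀ D[j₀]≡c₀)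
  ...   | refl with m≤n⇒m<n∨m≡n (s≤s⁻¹ c<e)
  ...     | inj₁ c<c₀  = there (rec j c j<n c<m D[j₀]≡c₀ c<c₀)
  ...     | inj₂ refl  = here refl

  Recorded-activate : ∀ {D h} → (k<n : length D < n) (0<m : 0 < m) → Recorded D h →
                      Recorded (D ++ [ 1 ]) ((length D , π (fromℕ< k<n) (fromℕ< 0<m)) ∷ h)
  Recorded-activate {D} k<n 0<m rec j c j<n c<m D′[j]≡e c<e with lookupD-∷ʳ D 1 j D′[j]≡e
  ... | inj₁ D[j]≡e       = there (rec j c j<n c<m D[j]≡e c<e)
  ... | inj₂ (refl , refl) with c<e
  ...   | s≤s z≤n = here refl

module Play (m n d : ℕ) (0<m : 0 < m) (π : Fin n → Fin m → Fin m) where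

  open Strategy m n d

  Initial : ℕ × Fin m → Set
  Initial (k , a) = Σ (k < n) λ k<n → a ≡ π (fromℕ< k<n) (fromℕ< 0<m)

  adversary-activates : ∀ h → length h < n → adversary h ≡ activate
  adversary-activates h k<n with length h <ᵇ n | <ᵇ-reflects-< (length h) n
  ... | true  | _        = refl
  ... | false | ofⁿ k≮n  = contradiction k<n k≮n

  adversary-scripted : ∀ ext h₀ → length h₀ ≡ n →
                       adversary (ext ++ h₀) ≡ nextRequest (drop (length ext) (script (profile (leader h₀)) 0))
  adversary-scripted ext h₀ |h₀|≡n
    with length (ext ++ h₀) <ᵇ n | <ᵇ-reflects-< (length (ext ++ h₀)) n
  ... | true  | ofʸ k<n = contradiction k<n (≤⇒≯ (subst (n ≤_) (sym |ext++h₀|) (m≤n+m n (length ext))))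
    where
    |ext++h₀| : length (ext ++ h₀) ≡ length ext + n
    |ext++h₀| = trans (length-++ ext) (cong (length ext +_) |h₀|≡n)
  ... | false | _ rewrite length-++ ext {h₀} | |h₀|≡n | m+n∸n≡m (length ext) n | drop-++ ext h₀ = refl

  run-activations : ∀ j k h → j + k ≡ n → length h ≡ k → Recorded π (replicate k 1) h → All Initial h →
    ∃ λ h₀ → length h₀ ≡ n × Recorded π (replicate n 1) h₀ × All Initial h₀ ×
             (∀ f → run adversary π (j + f) (replicate k 1) h ≡ run adversary π f (replicate n 1) h₀)
  run-activations zero    k h refl |h|≡k rec init = h , |h|≡k , rec , init , λ f → refl
  run-activations (suc j) k h j+k≡n |h|≡k rec init =
    let h₀ , |h₀|≡n , rec₀ , init₀ , run≡ =
          run-activations j (suc k) h′ (trans (+-suc j k) j+k≡n) (cong suc |h|≡k) rec′ ((k<n′ , refl) ∷ init)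
    in h₀ , |h₀|≡n , rec₀ , init₀ , λ f → begin
      run adversary π (suc j + f) (replicate k 1) h
        ≡⟨ run-activate adversary π (j + f) (replicate k 1) h activates k<n′ 0<m ⟩
      run adversary π (j + f) (replicate k 1 ++ [ 1 ]) h′
        ≡⟨ cong (λ D → run adversary π (j + f) D h′) (replicate-∷ʳ k 1) ⟩
      run adversary π (j + f) (replicate (suc k) 1) h′
        ≡⟨ run≡ f ⟩
      run adversary π f (replicate n 1) h₀ ∎
    where
    open ≡-Reasoning
    k<n : k < n
    k<n = subst (k <_) j+k≡n (s≤s (m≤n+m k j))
    k<n′ : length (replicate k 1) < n
    k<n′ = subst (_< n) (sym (length-replicate k)) k<n
    activates : adversary h ≡ activate
    activates = adversary-activates h (subst (_< n) (sym |h|≡k) k<n)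
    h′ : History m
    h′ = (length (replicate k 1) , π (fromℕ< k<n′) (fromℕ< 0<m)) ∷ h
    rec′ : Recorded π (replicate (suc k) 1) h′
    rec′ = subst (λ D → Recorded π D h′) (replicate-∷ʳ k 1) (Recorded-activate π {replicate k 1} k<n′ 0<m rec)

  module Scripted (h₀ : History m) (|h₀|≡n : length h₀ ≡ n) where

    plan : List ℕ
    plan = script (profile (leader h₀)) 0

    record Continues (e : ℕ) (D : List ℕ) (h : History m) (rest : List ℕ) (D′ : List ℕ) : Set where
      constructor continues
      field
        ext      : History m
        consumed : drop (length ext) plan ≡ rest
        recorded : Recorded π D′ (ext ++ h₀)
        runs     : ∀ f → run adversary π (e + f) D h ≡ run adversary π f D′ (ext ++ h₀)

    Continues-cast : ∀ {e e′ D h rest D′ D″} → e ≡ e′ → D′ ≡ D″ → Continues e D h rest D′ → Continues e′ D h rest D″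
    Continues-cast refl refl c = c

    Continues-refl : ∀ {ext rest D} → drop (length ext) plan ≡ rest → Recorded π D (ext ++ h₀) →
                     Continues 0 D (ext ++ h₀) rest D
    Continues-refl {ext} drop≡ rec = continues ext drop≡ rec λ f → refl

    Continues-step : ∀ {ext j c rest D} → drop (length ext) plan ≡ j ∷ rest → lookupD D j ≡ just c →
                     j < n → c < m → Recorded π D (ext ++ h₀) → Continues 1 D (ext ++ h₀) rest (incr D j)
    Continues-step {ext} {j} {c} {rest} {D} drop≡ D[j]≡c j<n c<m rec =
      continues (_ ∷ ext) (drop-suc (length ext) plan drop≡) (Recorded-request π {D} D[j]≡c j<n c<m rec)
        λ f → run-request adversary π f D (ext ++ h₀) j c requests D[j]≡c j<n c<m
      where
      requests : adversary (ext ++ h₀) ≡ request j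
      requests = trans (adversary-scripted ext h₀ |h₀|≡n) (cong nextRequest drop≡)

    Continues-bind : ∀ {e₁ e₂ D h rest₁ rest₂ D₁ D₂} → Continues e₁ D h rest₁ D₁ →
                     (∀ {ext} → drop (length ext) plan ≡ rest₁ → Recorded π D₁ (ext ++ h₀) →
                        Continues e₂ D₁ (ext ++ h₀) rest₂ D₂) →
                     Continues (e₁ + e₂) D h rest₂ D₂
    Continues-bind {e₁} {e₂} {D} {h} (continues ext₁ drop₁ rec₁ run₁) continue =
      let continues ext₂ drop₂ rec₂ run₂ = continue drop₁ rec₁
      in continues ext₂ drop₂ rec₂ λ f →
           trans (cong (λ e → run adversary π e D h) (+-assoc e₁ e₂ f)) (trans (run₁ (e₂ + f)) (run₂ f))

    run-block : ∀ e c A B {ext rest} → drop (length ext) plan ≡ replicate e (length A) ++ rest →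
                length A < n → c + e ≤ m → Recorded π (A ++ c ∷ B) (ext ++ h₀) →
                Continues e (A ++ c ∷ B) (ext ++ h₀) rest (A ++ (c + e) ∷ B)
    run-block zero    c A B drop≡ _   _     rec =
      Continues-cast refl (cong (λ x → A ++ x ∷ B) (sym (+-identityʳ c))) (Continues-refl drop≡ rec)
    run-block (suc e) c A B drop≡ A<n c+e≤m rec =
      Continues-cast refl (cong (λ x → A ++ x ∷ B) (sym (+-suc c e)))
        (Continues-bind (Continues-cast refl (incr-++-∷ A c B) (Continues-step drop≡ (lookupD-++-∷ A c B) A<n c<m rec))
          (λ drop₁ rec₁ → run-block e (suc c) A B drop₁ A<n (subst (_≤ m) (+-suc c e) c+e≤m) rec₁))
      where
      c<m : c < m
      c<m = ≤-trans (s≤s (m≤m+n c e)) (subst (_≤ m) (+-suc c e) c+e≤m)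

    run-script : ∀ F A {ext} → drop (length ext) plan ≡ script F (length A) → All Demand F →
                 length A + length F ≡ n → Recorded π (A ++ replicate (length F) 1) (ext ++ h₀) →
                 Continues (length (script F (length A))) (A ++ replicate (length F) 1) (ext ++ h₀) [] (A ++ F)
    run-script []      A drop≡ _ _ rec = Continues-refl drop≡ rec
    run-script (x ∷ F) A drop≡ ((1≤x , x≤m) ∷ demands) |A|+|x∷F|≡n rec =
      Continues-cast fuel (++-assoc A [ x ] F)
        (Continues-bind (Continues-cast refl A++x∷B (run-block (x ∸ 1) 1 A B drop≡ A<n 1+[x∸1]≤m rec))
          λ drop₁ rec₁ → run-script F (A ++ [ x ]) (trans drop₁ (cong (script F) (sym |A++x|))) demands |A++x|+|F|≡n rec₁)
      where
      B : List ℕ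
      B = replicate (length F) 1
      |A++x| : length (A ++ [ x ]) ≡ suc (length A)
      |A++x| = trans (length-++ A) (+-comm (length A) 1)
      |A++x|+|F|≡n : length (A ++ [ x ]) + length F ≡ n
      |A++x|+|F|≡n = trans (cong (_+ length F) |A++x|) (trans (sym (+-suc (length A) (length F))) |A|+|x∷F|≡n)
      A<n : length A < n
      A<n = subst (length A <_) |A|+|x∷F|≡n (m<m+n (length A) z<s)
      fuel : x ∸ 1 + length (script F (length (A ++ [ x ]))) ≡ length (script (x ∷ F) (length A))
      fuel = trans (cong (λ j → x ∸ 1 + length (script F j)) |A++x|)
                   (sym (trans (length-++ (replicate (x ∸ 1) (length A))) (cong (_+ _) (length-replicate (x ∸ 1)))))
      1+[x∸1]≡x : 1 + (x ∸ 1) ≡ x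
      1+[x∸1]≡x = m+[n∸m]≡n 1≤x
      1+[x∸1]≤m : 1 + (x ∸ 1) ≤ m
      1+[x∸1]≤m = subst (_≤ m) (sym 1+[x∸1]≡x) x≤m
      A++x∷B : A ++ (1 + (x ∸ 1)) ∷ B ≡ (A ++ [ x ]) ++ B
      A++x∷B = trans (cong (λ y → A ++ y ∷ B) 1+[x∸1]≡x) (sym (++-assoc A [ x ] B))

  module _ (n≥1 : 1 ≤ n) (n≤d : n ≤ d) (d≤nm : d ≤ n * m) where

    run-adversary : ∃ λ h₀ → length h₀ ≡ n × Recorded π (replicate n 1) h₀ × All Initial h₀ ×
                    ∃ λ ext → Recorded π (profile (leader h₀)) (ext ++ h₀) ×
                              run adversary π (suc d) [] [] ≡ just (profile (leader h₀) , ext ++ h₀)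
    run-adversary =
      let h₀ , |h₀|≡n , rec₀ , init₀ , run₀ = run-activations n 0 [] (+-identityʳ n) refl (Recorded-[] π) []
          open Scripted h₀ |h₀|≡n
          F = profile (leader h₀)
          |F|≡n = length-profile 0<m n≥1 n≤d d≤nm (leader h₀)
          continues ext drop≡ rec run₁ =
            run-script F [] refl (All-profile 0<m n≥1 n≤d d≤nm (leader h₀)) |F|≡n
              (subst (λ k → Recorded π (replicate k 1) h₀) (sym |F|≡n) rec₀)
      in h₀ , |h₀|≡n , rec₀ , init₀ , ext , rec , (begin
        run adversary π (suc d) [] []
          ≡⟨ cong (λ f → run adversary π f [] []) (suc-d 0<m n≥1 n≤d d≤nm (leader h₀)) ⟩
        run adversary π (n + (length plan + 1)) [] []
          ≡⟨ run₀ (length plan + 1) ⟩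
        run adversary π (length plan + 1) (replicate n 1) h₀
          ≡⟨ cong (λ k → run adversary π (length plan + 1) (replicate k 1) h₀) (sym |F|≡n) ⟩
        run adversary π (length plan + 1) (replicate (length F) 1) h₀
          ≡⟨ run₁ 1 ⟩
        run adversary π 1 F (ext ++ h₀)
          ≡⟨ run-stop adversary π 0 F (ext ++ h₀) (trans (adversary-scripted ext h₀ |h₀|≡n) (cong nextRequest drop≡)) ⟩
        just (F , ext ++ h₀) ∎)
      where open ≡-Reasoning

module _ (m n d : ℕ) (0<m : 0 < m) (n≥1 : 1 ≤ n) (n≤d : n ≤ d) (d≤nm : d ≤ n * m) where

  open Strategy m n d

  adversary-valid : Valid m n d adversary
  adversary-valid π _ =
    let h₀ , _ , _ , _ , ext , _ , run≡ = Play.run-adversary m n d 0<m π n≥1 n≤d d≤nm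
        i = leader h₀
    in (profile i , ext ++ h₀) , run≡ ,
       length-profile 0<m n≥1 n≤d d≤nm i , All-profile 0<m n≥1 n≤d d≤nm i , sum-profile 0<m n≥1 n≤d d≤nm i

-- Collisions under Cluster

T-not-≡ᵇ : ∀ {i j} → i ≢ j → T (not (i ≡ᵇ j))
T-not-≡ᵇ {i} {j} i≢j with i ≡ᵇ j in eq
... | false = _
... | true  = i≢j (≡ᵇ⇒≡ i j (subst T (sym eq) _))

collides-intro : ∀ {m} {h : History m} {i j a b} →
                 (i , a) ∈ h → (j , b) ∈ h → i ≢ j → toℕ a ≡ toℕ b → T (collides h)
collides-intro (here refl)  (here refl)  i≢j _   = contradiction refl i≢j
collides-intro (here refl)  (there j∈h)  i≢j a≡b =
  Equivalence.from T-∨ (inj₁ (any⁺ _ (lose j∈h (Equivalence.from T-∧ (T-not-≡ᵇ i≢j , ≡⇒≡ᵇ _ _ a≡b)))))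
collides-intro (there i∈h)  (here refl)  i≢j a≡b =
  Equivalence.from T-∨ (inj₁ (any⁺ _ (lose i∈h (Equivalence.from T-∧ (T-not-≡ᵇ (i≢j ∘ sym) , ≡⇒≡ᵇ _ _ (sym a≡b))))))
collides-intro (there i∈h)  (there j∈h)  i≢j a≡b =
  Equivalence.from T-∨ (inj₂ (collides-intro i∈h j∈h i≢j a≡b))

module _ {m n : ℕ} .{{_ : NonZero m}} (x : Vec (Fin m) n) where

  toℕ-cluster : ∀ i t → toℕ (cluster x i t) ≡ (toℕ (lookup x i) + toℕ t) % m
  toℕ-cluster i t = toℕ-fromℕ< _

  toℕ-cluster-0 : ∀ i (0<m : 0 < m) → toℕ (cluster x i (fromℕ< 0<m)) ≡ toℕ (lookup x i)
  toℕ-cluster-0 i 0<m = begin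
    toℕ (cluster x i (fromℕ< 0<m))                ≡⟨ toℕ-cluster i (fromℕ< 0<m) ⟩
    (toℕ (lookup x i) + toℕ (fromℕ< 0<m)) % m     ≡⟨ cong (λ t → (toℕ (lookup x i) + t) % m) (toℕ-fromℕ< 0<m) ⟩
    (toℕ (lookup x i) + 0) % m                    ≡⟨ cong (_% m) (+-identityʳ _) ⟩
    toℕ (lookup x i) % m                          ≡⟨ m<n⇒m%n≡m (toℕ<n (lookup x i)) ⟩
    toℕ (lookup x i)                              ∎
    where open ≡-Reasoning

  toℕ-cluster-cdist : ∀ i {a} (b : Fin m) → toℕ (lookup x i) ≡ toℕ a →
                      (s<m : cdist m (toℕ a) (toℕ b) < m) → toℕ (cluster x i (fromℕ< s<m)) ≡ toℕ b
  toℕ-cluster-cdist i {a} b xᵢ≡a s<m = begin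
    toℕ (cluster x i (fromℕ< s<m))                       ≡⟨ toℕ-cluster i (fromℕ< s<m) ⟩
    (toℕ (lookup x i) + toℕ (fromℕ< s<m)) % m            ≡⟨ cong₂ (λ u t → (u + t) % m) xᵢ≡a (toℕ-fromℕ< s<m) ⟩
    (toℕ a + cdist m (toℕ a) (toℕ b)) % m                ≡⟨ +-cdist-% m _ _ (toℕ<n a) (toℕ<n b) ⟩
    toℕ b                                                ∎
    where open ≡-Reasoning

collisionOn-collides : ∀ {m} {D} {h : History m} → T (collides h) → collisionOn (just (D , h)) ≡ 1
collisionOn-collides {h = h} c with collides h
... | true = refl

module _ (m n d : ℕ) .{{_ : NonZero m}} (n≥1 : 1 ≤ n) (n≤d : n ≤ d) (d≤nm : d ≤ n * m) (x : Vec (Fin m) n) where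

  private
    0<m : 0 < m
    0<m = >-nonZero⁻¹ m

  open Strategy m n d
  open Separation m K using (spread; close-pair)
  open Play m n d 0<m (cluster x)

  module _ {h₀ : History m} (rec₀ : Recorded (cluster x) (replicate n 1) h₀) where

    start : Fin n → Fin m
    start p = cluster x (fromℕ< (toℕ<n p)) (fromℕ< 0<m)

    toℕ-start : ∀ p → toℕ (start p) ≡ toℕ (lookup x p)
    toℕ-start p = trans (toℕ-cluster-0 x _ 0<m) (cong (toℕ ∘ lookup x) (fromℕ<-toℕ p (toℕ<n p)))

    start∈h₀ : ∀ p → (toℕ p , start p) ∈ h₀
    start∈h₀ p = rec₀ (toℕ p) 0 (toℕ<n p) 0<m (lookupD-replicate 1 (toℕ<n p)) (s≤s z≤n)

    has-follower : spread x ≡ false → Any (λ e → Any (Follows e) h₀) h₀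
    has-follower ¬sp =
      let p , q , p≢q , close = close-pair x ¬sp
      in lose (start∈h₀ p) (lose (start∈h₀ q)
           (p≢q ∘ toℕ-injective , subst₂ (λ u v → cdist m u v ≤ K) (sym (toℕ-start p)) (sym (toℕ-start q)) close))

    module _ {ext : History m} (init₀ : All Initial h₀)
             (rec : Recorded (cluster x) (profile (leader h₀)) (ext ++ h₀)) where

      leader-collides : spread x ≡ false → T (collides (ext ++ h₀))
      leader-collides ¬sp =
        let a , la∈h₀ , follower = leader-spec h₀ (has-follower ¬sp)
            (j , b) , jb∈h₀ , i≢j , s≤K = find follower
            i<n , a≡start = All.lookup init₀ la∈h₀
            s<m = ≤-<-trans s≤K (K<m 0<m)
            xᵢ≡a = sym (trans (cong toℕ a≡start) (toℕ-cluster-0 x _ 0<m))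
            covered = rec (leader h₀) _ i<n s<m (lookupD-profile i<n) (s≤s s≤K)
        in collides-intro covered (∈-++⁺ʳ ext jb∈h₀) i≢j (toℕ-cluster-cdist x _ b xᵢ≡a s<m)

  unspread-collides : spread x ≡ false → collisionOn (run adversary (cluster x) (suc d) [] []) ≡ 1
  unspread-collides ¬sp with run-adversary n≥1 n≤d d≤nm
  ... | h₀ , _ , rec₀ , init₀ , ext , rec , run≡ rewrite run≡ =
    collisionOn-collides {D = profile (leader h₀)} {h = ext ++ h₀} (leader-collides rec₀ init₀ rec ¬sp)

#collisions : ∀ m n d .{{_ : NonZero m}} → Adversary m → ℕ
#collisions m n d Z = sum (map (λ x → collisionOn (run {m} {n} Z (cluster x) (suc d) [] [])) (allVecs {m} n))

module _ (m n d : ℕ) .{{_ : NonZero m}} (n≥1 : 1 ≤ n) (n≤d : n ≤ d) (d≤nm : d ≤ n * m) where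

  open Strategy m n d
  open Separation m K using (spread; #unspread)

  #unspread≤#collisions : #unspread n ≤ #collisions m n d adversary
  #unspread≤#collisions = sum-map-mono (allVecs n) 𝟙-unspread≤
    where
    𝟙-unspread≤ : ∀ x → 𝟙 (not (spread x)) ≤ collisionOn (run adversary (cluster x) (suc d) [] [])
    𝟙-unspread≤ x with spread x in sp
    ... | true  = z≤n
    ... | false = ≤-reflexive (sym (unspread-collides m n d n≥1 n≤d d≤nm x sp))

module _ (m j d : ℕ) .{{_ : NonZero m}} (2n≤d : 2 * (2 + j) ≤ d) where

  private
    n : ℕ
    n = 2 + j
    0<m : 0 < m
    0<m = >-nonZero⁻¹ m

  open Strategy m n d
  open Separation m K using (S; 2*S)

  m≤S : M ≤ R → m ≤ S n
  m≤S M≤R = *-cancelˡ-≤ 2 (begin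
    2 * m                  ≤⟨ 2*m≤[2+j]*[1+j]*m j m ⟩
    n * (1 + j) * m        ≡⟨ cong (n * (1 + j) *_) (suc-M 0<m) ⟨
    n * (1 + j) * suc M    ≡⟨ cong (λ k → n * (1 + j) * suc k) (m≥n⇒m⊓n≡n M≤R) ⟨
    n * (1 + j) * suc K    ≡⟨ 2*S (suc j) ⟨
    2 * S n                ∎)
    where open ≤-Reasoning

  n*n*d≤8*S : R ≤ M → n * n * d ≤ 8 * S n
  n*n*d≤8*S R≤M = begin
    n * n * d                              ≡⟨ cong (n * n *_) d≡2n+e ⟩
    n * n * (2 * n + e)                    ≤⟨ n*n*[2n+e]≤4*[n*[n∸1]*[n+e+1]] j e ⟩
    4 * (n * (1 + j) * suc (n + e))        ≡⟨ cong (λ k → 4 * (n * (1 + j) * suc k)) K≡n+e ⟨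
    4 * (n * (1 + j) * suc K)              ≡⟨ cong (4 *_) (2*S (suc j)) ⟨
    4 * (2 * S n)                          ≡⟨ *-assoc 4 2 (S n) ⟨
    8 * S n                                ∎
    where
    open ≤-Reasoning
    e : ℕ
    e = d ∸ 2 * n
    d≡2n+e : d ≡ 2 * n + e
    d≡2n+e = sym (m+[n∸m]≡n 2n≤d)
    regroup : ∀ n e → 2 * n + e ≡ n + (n + e)
    regroup = solve-∀
    K≡n+e : K ≡ n + e
    K≡n+e = begin-equality
      K                      ≡⟨ m≤n⇒m⊓n≡m R≤M ⟩
      d ∸ n                  ≡⟨ cong (_∸ n) d≡2n+e ⟩
      2 * n + e ∸ n          ≡⟨ cong (_∸ n) (regroup n e) ⟩
      n + (n + e) ∸ n        ≡⟨ m+n∸m≡n n (n + e) ⟩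
      n + e                  ∎

  module _ (d≤nm : d ≤ n * m) where

    private
      n≤d : n ≤ d
      n≤d = ≤-trans (m≤m+n n (n + 0)) 2n≤d
      P : ℕ
      P = m ^ n
      G : ℕ
      G = Separation.#unspread m K n
      C : ℕ
      C = #collisions m n d adversary
      G≤C : G ≤ C
      G≤C = #unspread≤#collisions m n d (s≤s z≤n) n≤d d≤nm
      P*S≤G*[m+S] : P * S n ≤ G * (m + S n)
      P*S≤G*[m+S] = Separation.m^n*S≤#unspread*[m+S] m K (K<m 0<m) n

    collisions-bound : P ≤ C * 16 ⊎ n * n * d * P ≤ C * (16 * m)
    collisions-bound with m ≤? S n
    ... | yes m≤S = inj₁ (begin
      P        ≤⟨ P*S≤G*[m+S]∧m≤S⇒P≤2*G {P} {S n} {G} {m} m≤S (<-≤-trans 0<m m≤S) P*S≤G*[m+S] ⟩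
      2 * G    ≤⟨ *-monoˡ-≤ G {2} {16} (s≤s (s≤s z≤n)) ⟩
      16 * G   ≤⟨ *-monoʳ-≤ 16 G≤C ⟩
      16 * C   ≡⟨ *-comm 16 C ⟩
      C * 16   ∎)
      where open ≤-Reasoning
    ... | no m≰S with ≤-total R M
    ...   | inj₂ M≤R = contradiction (m≤S M≤R) m≰S
    ...   | inj₁ R≤M = inj₂ (begin
      n * n * d * P        ≤⟨ *-monoˡ-≤ P (n*n*d≤8*S R≤M) ⟩
      8 * S n * P          ≡⟨ trans (*-assoc 8 (S n) P) (cong (8 *_) (*-comm (S n) P)) ⟩
      8 * (P * S n)        ≤⟨ *-monoʳ-≤ 8 (P*S≤G*[m+S]∧S≤m⇒P*S≤2*m*G {P} {S n} {G} {m} (<⇒≤ (≰⇒> m≰S)) P*S≤G*[m+S]) ⟩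
      8 * (2 * m * G)      ≤⟨ *-monoʳ-≤ 8 (*-monoʳ-≤ (2 * m) G≤C) ⟩
      8 * (2 * m * C)      ≡⟨ regroup m C ⟩
      C * (16 * m)         ∎)
      where
      open ≤-Reasoning
      regroup : ∀ m C → 8 * (2 * m * C) ≡ C * (16 * m)
      regroup = solve-∀

-- Imported only here: ℤ's prefix `+_` would make the sections `(x +_)` above ambiguous.
open import Data.Integer as ℤ using (+_; +≤+)
import Data.Integer.Properties as ℤ
open import Data.Rational using (ℚ; _/_; 0ℚ; 1ℚ; _⊓_) renaming (_<_ to _<ℚ_; _≤_ to _≤ℚ_; _*_ to _*ℚ_)
import Data.Rational.Properties as ℚ
import Data.Rational.Unnormalised as ℚᵘ
import Data.Rational.Unnormalised.Properties as ℚᵘ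

-- ℚ's `_/_` normalises, so compare in ℚᵘ, where `+ a / suc b` becomes `mkℚᵘ (+ a) b`.
a/b*c/e≤g/h : ∀ a b c e g h .{{_ : NonZero b}} .{{_ : NonZero e}} .{{_ : NonZero h}} →
            a * c * h ≤ g * (b * e) → (+ a / b) *ℚ (+ c / e) ≤ℚ + g / h
a/b*c/e≤g/h a (suc b) c (suc e) g (suc h) ac*h≤g*be =
  ℚ.toℚᵘ-cancel-≤ (ℚᵘ.≤-respˡ-≃ (ℚᵘ.≃-sym (ℚ.toℚᵘ-homo-* (+ a / suc b) (+ c / suc e)))
    (ℚᵘ.≤-respˡ-≃ (ℚᵘ.≃-sym (ℚᵘ.*-cong (ℚ.toℚᵘ-fromℚᵘ (ℚᵘ.mkℚᵘ (+ a) b)) (ℚ.toℚᵘ-fromℚᵘ (ℚᵘ.mkℚᵘ (+ c) e))))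
      (ℚᵘ.≤-respʳ-≃ (ℚᵘ.≃-sym (ℚ.toℚᵘ-fromℚᵘ (ℚᵘ.mkℚᵘ (+ g) h)))
        (ℚᵘ.*≤* (subst₂ ℤ._≤_ (trans (ℤ.pos-* (a * c) (suc h)) (cong (ℤ._* + suc h) (ℤ.pos-* a c)))
                              (ℤ.pos-* g (suc b * suc e)) (+≤+ ac*h≤g*be))))))

[1/16]*[1⊓q]≤p : ∀ N m C P .{{_ : NonZero m}} .{{P≢0 : NonZero P}} →
               P ≤ C * 16 ⊎ N * P ≤ C * (16 * m) →
               (+ 1 / 16) *ℚ (1ℚ ⊓ (+ N / m)) ≤ℚ + C / P
[1/16]*[1⊓q]≤p N m C P (inj₁ P≤16C) = ℚ.≤-trans (ℚ.*-monoˡ-≤-nonNeg (+ 1 / 16) (ℚ.p⊓q≤p 1ℚ (+ N / m)))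
  (a/b*c/e≤g/h 1 16 1 1 C P (subst (_≤ C * 16) (sym (+-identityʳ P)) P≤16C))
[1/16]*[1⊓q]≤p N m C P (inj₂ NP≤16mC) = ℚ.≤-trans (ℚ.*-monoˡ-≤-nonNeg (+ 1 / 16) (ℚ.p⊓q≤q 1ℚ (+ N / m)))
  (a/b*c/e≤g/h 1 16 N m C P (subst (_≤ C * (16 * m)) (cong (_* P) (sym (+-identityʳ N))) NP≤16mC))

pCluster-bound : (m n d : ℕ) .{{_ : NonZero m}} → 2 ≤ n → 2 * n ≤ d → d ≤ n * m →
  ∃ λ (Z : Adversary m) → Valid m n d Z × (+ 1 / 16 *ℚ (1ℚ ⊓ ((+ (n * n * d)) / m)) ≤ℚ pCluster m n d Z)
pCluster-bound m n@(suc (suc j)) d (s≤s (s≤s z≤n)) 2n≤d d≤nm =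
  adversary , adversary-valid m n d (>-nonZero⁻¹ m) (s≤s z≤n) (≤-trans (m≤m+n n (n + 0)) 2n≤d) d≤nm ,
  [1/16]*[1⊓q]≤p (n * n * d) m (#collisions m n d adversary) (m ^ n) {{P≢0 = m^n≢0 m n}}
    (collisions-bound m j d 2n≤d d≤nm)
  where open Strategy m n d using (adversary)

lemma3p7 : Σ ℚ λ c → 0ℚ <ℚ c × ((m n d : ℕ) .{{_ : NonZero m}} → 2 ≤ n → 2 * n ≤ d → d ≤ n * m →
    ∃ λ (Z : Adversary m) → Valid m n d Z × (c *ℚ (1ℚ ⊓ ((+ (n * n * d)) / m)) ≤ℚ pCluster m n d Z))
lemma3p7 = + 1 / 16 , ℚ.positive⁻¹ (+ 1 / 16) , pCluster-bound
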